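{- Let $X=\{(2^m,2^k): m,k\geq 0 \text{ integers}\}\subseteq\mathbb{N}^2$ and $E=\{(a,b)\in\mathbb{N}^2: b\leq\log_2 a\}\cup\{(a,b)\in\mathbb{N}^2: a\leq \log_2 b\}$. There is $M_0$ (one may take $M_0=2^{64}$) such that for every integer $M>M_0$ there exist $z_0,w_0$ such that the square $S_M=\{(t_1,t_2): z_0\leq t_1\leq z_0+M,\ w_0\leq t_2\leq w_0+M\}$ satisfies $S_M\subseteq E$ and $|FS(X)\cap S_M|\geq \frac14 M\log_2 M$.
   Context: $\mathbb{N}=\{1,2,\dots\}$. For $X\subseteq\mathbb{N}^2$, $FS(X)$ is the set of all finite sums of distinct elements of $X$. -}

module Defs where

open import Data.Nat using (ℕ; _+_; _*_; _^_; _≤_; _<_)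
open import Data.Product using (_×_; _,_; ∃-syntax; proj₁; proj₂)
open import Data.List using (List; []; _∷_; length)
open import Data.List.Relation.Unary.All using (All)
open import Data.List.Relation.Unary.Unique.Propositional using (Unique)
open import Relation.Binary.PropositionalEquality using (_≡_; _≢_)

-- Points of ℕ² (Agda's ℕ contains 0; positivity is imposed where needed).
Point : Set
Point = ℕ × ℕ

InX : Point → Set
InX p = ∃[ m ] ∃[ k ] (p ≡ (2 ^ m , 2 ^ k))

sumPts : List Point → Point
sumPts [] = (0 , 0)
sumPts ((a , b) ∷ ps) = (a + proj₁ (sumPts ps) , b + proj₂ (sumPts ps))

InFS : Point → Set
InFS p = ∃[ L ] (Unique L × All InX L × L ≢ [] × sumPts L ≡ p)

-- E = {(a,b) ∈ ℕ² : b ≤ log₂ a} ∪ {(a,b) ∈ ℕ² : a ≤ log₂ b}, with ℕ = {1,2,...}.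
-- For naturals a ≥ 1, b: b ≤ log₂ a  ⟺  2^b ≤ a.
data InE : Point → Set where
  left  : ∀ {a b} → 1 ≤ a → 1 ≤ b → 2 ^ b ≤ a → InE (a , b)
  right : ∀ {a b} → 1 ≤ a → 1 ≤ b → 2 ^ a ≤ b → InE (a , b)

InSquare : ℕ → ℕ → ℕ → Point → Set
InSquare M z0 w0 (t1 , t2) = (z0 ≤ t1 × t1 ≤ z0 + M) × (w0 ≤ t2 × t2 ≤ w0 + M)

-- |A| ≥ (1/4) M log₂ M  ⟺  M log₂ M ≤ 4|A|  ⟺  log₂ M ≤ 4|A|/M  ⟺  M^M ≤ 2^(4|A|)   (M ≥ 1)
QuarterMLogM≤ : ℕ → ℕ → Set
QuarterMLogM≤ M c = M ^ M ≤ 2 ^ (4 * c)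

-- The square is placed far above the curve b = 2^a: its first coordinates lie in [M, 2M] and
-- its second coordinates exceed B ≥ 2^(2M), so it lies in E. With B = 2^L + … + 2^(L+M-2)
-- (M - 1 consecutive powers, L large), every point (M + t, B + 2^j) with t ≤ M and 2^j ≤ M is a
-- sum of M distinct points of X: pair the M exponents j, L, …, L+M-2 of the second coordinate
-- with M exponents from {0, 1} whose powers add up to M + t. These are (M + 1)(⌊log₂ M⌋ + 1)
-- points of the square, which is more than (1/4) M log₂ M.
module Submission where

open import Defs
open import Data.Nat using (ℕ; _^_; _<_)
open import Data.Product using (_×_; ∃-syntax)
open import Data.List using (List; length)
open import Data.List.Relation.Unary.All using (All)
open import Data.List.Relation.Unary.Unique.Propositional using (Unique)

open import Data.Nat using (zero; suc; _+_; _*_; _≤_; z≤n; s≤s; s≤s⁻¹; _<?_)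
open import Data.Nat.Logarithm using (⌊log₂_⌋; ⌊log₂[2^n]⌋≡n)
open import Data.Nat.Properties
open import Data.Product using (_,_; proj₁; proj₂)
open import Data.List using ([]; _∷_; _++_; map; zipWith; upTo; cartesianProductWith)
open import Data.Nat.ListAction using (sum)
open import Data.List.Properties using (length-++; length-map; length-upTo)
open import Data.List.Membership.Propositional using (_∈_)
open import Data.List.Membership.Propositional.Properties using (∈-cartesianProductWith⁻; ∈-upTo⁻)
open import Data.List.Relation.Unary.All using ([]; _∷_; tabulate; universal)
import Data.List.Relation.Unary.All.Properties as All
open import Data.List.Relation.Unary.AllPairs using ([]; _∷_)
open import Data.List.Relation.Unary.Unique.Propositional.Properties as Unique
  using (upTo⁺; cartesianProductWith⁺)
open import Relation.Binary.PropositionalEquality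
open import Relation.Nullary using (yes; no; contradiction)

length-cartesianProductWith : ∀ {A B C : Set} (f : A → B → C) xs ys →
  length (cartesianProductWith f xs ys) ≡ length xs * length ys
length-cartesianProductWith f [] ys = refl
length-cartesianProductWith f (x ∷ xs) ys = begin
  length (map (f x) ys ++ cartesianProductWith f xs ys)
    ≡⟨ length-++ (map (f x) ys) ⟩
  length (map (f x) ys) + length (cartesianProductWith f xs ys)
    ≡⟨ cong₂ _+_ (length-map (f x) ys) (length-cartesianProductWith f xs ys) ⟩
  length ys + length xs * length ys ∎
  where open ≡-Reasoning

zipWith-universal : ∀ {A B C : Set} {P : C → Set} (f : A → B → C) →
  (∀ x y → P (f x y)) → ∀ xs ys → All P (zipWith f xs ys)
zipWith-universal f Pf [] ys = []
zipWith-universal f Pf (x ∷ xs) [] = []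
zipWith-universal f Pf (x ∷ xs) (y ∷ ys) = Pf x y ∷ zipWith-universal f Pf xs ys

zipWith-Unique : ∀ {A B C : Set} (f : A → B → C) → (∀ {a b c d} → f a b ≡ f c d → b ≡ d) →
  ∀ xs {ys} → Unique ys → Unique (zipWith f xs ys)
zipWith-Unique f inj [] _ = []
zipWith-Unique f inj (x ∷ xs) [] = []
zipWith-Unique f inj (x ∷ xs) (y∉ys ∷ ys!) = fresh xs y∉ys ∷ zipWith-Unique f inj xs ys!
  where
  fresh : ∀ {y ys} xs → All (y ≢_) ys → All (f x y ≢_) (zipWith f xs ys)
  fresh [] _ = []
  fresh (_ ∷ _) [] = []
  fresh (_ ∷ xs) (y≢y′ ∷ ps) = (λ eq → y≢y′ (inj eq)) ∷ fresh xs ps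

2^-injective : ∀ {i j} → 2 ^ i ≡ 2 ^ j → i ≡ j
2^-injective {i} {j} eq = begin
  i               ≡⟨ sym (⌊log₂[2^n]⌋≡n i) ⟩
  ⌊log₂ (2 ^ i) ⌋ ≡⟨ cong ⌊log₂_⌋ eq ⟩
  ⌊log₂ (2 ^ j) ⌋ ≡⟨ ⌊log₂[2^n]⌋≡n j ⟩
  j               ∎
  where open ≡-Reasoning

2^-mono-< : ∀ {i j} → i < j → 2 ^ i < 2 ^ j
2^-mono-< = ^-monoʳ-< 2 (s≤s (s≤s z≤n))

log₂-bracket : ∀ n → ∃[ r ] (2 ^ r ≤ suc n × suc n < 2 ^ suc r)
log₂-bracket zero = 0 , s≤s z≤n , s≤s (s≤s z≤n)
log₂-bracket (suc n) with log₂-bracket n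
... | r , lo , hi with suc (suc n) <? 2 ^ suc r
...   | yes below = r , m≤n⇒m≤1+n lo , below
...   | no ¬below = suc r , ≤-reflexive (sym n+2≡2^r+1) ,
                    subst (_< 2 ^ suc (suc r)) (sym n+2≡2^r+1) (2^-mono-< {suc r} ≤-refl)
  where
  n+2≡2^r+1 : suc (suc n) ≡ 2 ^ suc r
  n+2≡2^r+1 = ≤-antisym hi (≮⇒≥ ¬below)

powSum : List ℕ → ℕ
powSum es = sum (map (2 ^_) es)

pow2Point : ℕ → ℕ → Point
pow2Point m k = (2 ^ m , 2 ^ k)

sumPts-zipWith-pow2Point : ∀ ms ks → length ms ≡ length ks →
  sumPts (zipWith pow2Point ms ks) ≡ (powSum ms , powSum ks)
sumPts-zipWith-pow2Point [] [] _ = refl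
sumPts-zipWith-pow2Point (m ∷ ms) (k ∷ ks) eq
  rewrite sumPts-zipWith-pow2Point ms ks (suc-injective eq) = refl

-- Distinct second exponents already make the points (2^mᵢ, 2^kᵢ) distinct.
powSums-InFS : ∀ ms ks → length ms ≡ length ks → Unique ks → ks ≢ [] →
  InFS (powSum ms , powSum ks)
powSums-InFS [] [] _ _ ks≢[] = contradiction refl ks≢[]
powSums-InFS (m ∷ ms) (k ∷ ks) eq ks! _ =
  zipWith pow2Point (m ∷ ms) (k ∷ ks) ,
  zipWith-Unique pow2Point (λ eq′ → 2^-injective (cong proj₂ eq′)) (m ∷ ms) ks! ,
  zipWith-universal pow2Point (λ m k → m , k , refl) (m ∷ ms) (k ∷ ks) ,
  (λ ()) ,
  sumPts-zipWith-pow2Point (m ∷ ms) (k ∷ ks) eq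

-- n + t = 2·t + 1·(n - t) as a sum of n powers of two with exponents in {0, 1}.
unitsAndTwos : ℕ → ℕ → List ℕ
unitsAndTwos zero _ = []
unitsAndTwos (suc n) zero = 0 ∷ unitsAndTwos n zero
unitsAndTwos (suc n) (suc t) = 1 ∷ unitsAndTwos n t

length-unitsAndTwos : ∀ n t → length (unitsAndTwos n t) ≡ n
length-unitsAndTwos zero _ = refl
length-unitsAndTwos (suc n) zero = cong suc (length-unitsAndTwos n zero)
length-unitsAndTwos (suc n) (suc t) = cong suc (length-unitsAndTwos n t)

powSum-unitsAndTwos : ∀ n t → t ≤ n → powSum (unitsAndTwos n t) ≡ n + t
powSum-unitsAndTwos zero .zero z≤n = refl
powSum-unitsAndTwos (suc n) zero _ = cong suc (powSum-unitsAndTwos n zero z≤n)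
powSum-unitsAndTwos (suc n) (suc t) (s≤s t≤n) = begin
  2 + powSum (unitsAndTwos n t) ≡⟨ cong (2 +_) (powSum-unitsAndTwos n t t≤n) ⟩
  2 + (n + t)                   ≡⟨ cong suc (sym (+-suc n t)) ⟩
  suc (n + suc t)               ∎
  where open ≡-Reasoning

square-InE : ∀ {M z0 w0} p → 1 ≤ z0 → 2 ^ (z0 + M) ≤ w0 → InSquare M z0 w0 p → InE p
square-InE {M} {z0} (a , b) 1≤z0 2^[z0+M]≤w0 ((z0≤a , a≤z0+M) , (w0≤b , _)) =
  right (≤-trans 1≤z0 z0≤a) (≤-trans (m^n>0 2 (z0 + M)) 2^[z0+M]≤b) (≤-trans (^-monoʳ-≤ 2 a≤z0+M) 2^[z0+M]≤b)
  where
  2^[z0+M]≤b = ≤-trans 2^[z0+M]≤w0 w0≤b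

QuarterMLogM≤-grid : ∀ {M n} → M < 2 ^ n → QuarterMLogM≤ M (n * suc M)
QuarterMLogM≤-grid {M} {n} M<2^n = begin
  M ^ M                ≤⟨ ^-monoˡ-≤ M (<⇒≤ M<2^n) ⟩
  (2 ^ n) ^ M          ≡⟨ ^-*-assoc 2 n M ⟩
  2 ^ (n * M)          ≤⟨ ^-monoʳ-≤ 2 (*-monoʳ-≤ n (n≤1+n M)) ⟩
  2 ^ (n * suc M)      ≤⟨ ^-monoʳ-≤ 2 (m≤n*m (n * suc M) 4) ⟩
  2 ^ (4 * (n * suc M)) ∎
  where open ≤-Reasoning

module Grid (m r : ℕ) where

  M : ℕ
  M = suc (suc m)

  -- L exceeds every row exponent j ≤ r and every first coordinate, which is ≤ 2M.
  L : ℕ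
  L = M + M + suc r

  block : List ℕ
  block = map (L +_) (upTo (suc m))

  B : ℕ
  B = powSum block

  2^[M+M]≤B : 2 ^ (M + M) ≤ B
  2^[M+M]≤B = ≤-trans (^-monoʳ-≤ 2 (≤-trans (m≤m+n (M + M) (suc r)) (m≤m+n L 0)))
                      (m≤m+n (2 ^ (L + 0)) _)

  gridPoint : ℕ → ℕ → Point
  gridPoint j t = (M + t , B + 2 ^ j)

  grid : List Point
  grid = cartesianProductWith gridPoint (upTo (suc r)) (upTo (suc M))

  length-grid : length grid ≡ suc r * suc M
  length-grid = trans (length-cartesianProductWith gridPoint (upTo (suc r)) (upTo (suc M)))
                      (cong₂ _*_ (length-upTo (suc r)) (length-upTo (suc M)))

  gridPoint-injective : ∀ {j j′ t t′} → gridPoint j t ≡ gridPoint j′ t′ → j ≡ j′ × t ≡ t′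
  gridPoint-injective eq =
    2^-injective (+-cancelˡ-≡ B _ _ (cong proj₂ eq)) , +-cancelˡ-≡ M _ _ (cong proj₁ eq)

  grid-Unique : Unique grid
  grid-Unique = cartesianProductWith⁺ gridPoint gridPoint-injective (upTo⁺ (suc r)) (upTo⁺ (suc M))

  gridPoint-InFS : ∀ {j t} → j ≤ r → t ≤ M → InFS (gridPoint j t)
  gridPoint-InFS {j} {t} j≤r t≤M =
    subst InFS (cong₂ _,_ (powSum-unitsAndTwos M t t≤M) (+-comm (2 ^ j) B))
      (powSums-InFS (unitsAndTwos M t) (j ∷ block) lengths (j∉block ∷ block-Unique) (λ ()))
    where
    lengths : length (unitsAndTwos M t) ≡ length (j ∷ block)
    lengths = trans (length-unitsAndTwos M t)
      (cong suc (sym (trans (length-map (L +_) (upTo (suc m))) (length-upTo (suc m)))))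
    block-Unique : Unique block
    block-Unique = Unique.map⁺ (+-cancelˡ-≡ L _ _) (upTo⁺ (suc m))
    j<L : j < L
    j<L = ≤-trans (s≤s j≤r) (m≤n+m (suc r) (M + M))
    j∉block : All (j ≢_) block
    j∉block = All.map⁺ (universal (λ i → <⇒≢ (≤-trans j<L (m≤m+n L i))) (upTo (suc m)))

  gridPoint-InSquare : ∀ {j t} → 2 ^ j ≤ M → t ≤ M → InSquare M M B (gridPoint j t)
  gridPoint-InSquare {j} {t} 2^j≤M t≤M =
    (m≤m+n M t , +-monoʳ-≤ M t≤M) , (m≤m+n B (2 ^ j) , +-monoʳ-≤ B 2^j≤M)

  grid-All : 2 ^ r ≤ M → All (λ p → InSquare M M B p × InFS p) grid
  grid-All 2^r≤M = tabulate good
    where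
    good : ∀ {p} → p ∈ grid → InSquare M M B p × InFS p
    good p∈grid with j , t , j∈ , t∈ , refl ←
                       ∈-cartesianProductWith⁻ gridPoint (upTo (suc r)) (upTo (suc M)) p∈grid =
      let j≤r = s≤s⁻¹ (∈-upTo⁻ j∈)
          t≤M = s≤s⁻¹ (∈-upTo⁻ t∈)
      in gridPoint-InSquare {j} {t} (≤-trans (^-monoʳ-≤ 2 j≤r) 2^r≤M) t≤M , gridPoint-InFS j≤r t≤M

proposition3p3 : ∀ (M : ℕ) → 2 ^ 64 < M →
    ∃[ z0 ] ∃[ w0 ]
      ((∀ p → InSquare M z0 w0 p → InE p) ×
       ∃[ L ] (Unique L × All (λ p → InSquare M z0 w0 p × InFS p) L
               × QuarterMLogM≤ M (length L)))
proposition3p3 zero ()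
proposition3p3 (suc zero) (s≤s ())
proposition3p3 (suc (suc m)) _ with r , 2^r≤M , M<2^[1+r] ← log₂-bracket (suc m) =
  M , B ,
  (λ p → square-InE p (s≤s z≤n) 2^[M+M]≤B) ,
  grid , grid-Unique , grid-All 2^r≤M ,
  subst (QuarterMLogM≤ M) (sym length-grid) (QuarterMLogM≤-grid {n = suc r} M<2^[1+r])
  where open Grid m r
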